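{- Let $k\geq 3$ and $n\geq 1$ be integers. All $(k,n)$-accordions have the same number of spanning trees; denote this common number by $\tau(A(k,n))$. Moreover, for all integers $k\geq 3$ and $n\geq 3$, \[ \tau(A(k,n))=k\cdot \tau(A(k,n-1))-\tau(A(k,n-2)). \]
   Context: For integers $k\geq 3$, $n\geq 1$, a $(k,n)$-accordion is any graph $A_n$ obtained as follows. (i) Let $A_1$ be a $k$-cycle $C^k_1$, embedded in the plane, and designate all its edges as free. (ii) For $i=2,\ldots,n$: choose a free edge $(r,s)$ of $A_{i-1}$ and add a new $k$-cycle $C^k_i$ that consists of the edge $(r,s)$ together with a path of $k-1$ edges through $k-2$ new nodes from $r$ to $s$, such that the resulting graph $A_i$ is planar embedded; designate as free exactly the edges incident to a new node of this step. The number of spanning trees of a graph $G$ is denoted $\tau(G)$. -}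

module Defs where

open import Data.Nat using (ℕ; zero; suc; _+_; _∸_; _*_; _≤_)
open import Data.Bool using (Bool; true; false)
open import Data.Fin using (Fin)
open import Data.Fin.Subset using (Subset) renaming (_∈_ to _∈ₛ_)
open import Data.List using (List; []; _∷_; _++_; length; map; upTo; lookup)
open import Data.List.Relation.Unary.Unique.Propositional using (Unique)
open import Data.List.Membership.Propositional using (_∈_)
open import Data.Product using (Σ; _×_; _,_; proj₁; proj₂)
open import Data.Sum using (_⊎_)
open import Relation.Binary.PropositionalEquality using (_≡_; _≢_)
open import Relation.Nullary using (¬_)

-- Finite (multi)graphs: vertices 0 .. V-1, edges given by a list of
-- endpoint pairs; edge e is identified with its index in that list.

record Graph : Set where
  constructor graph
  field
    V     : ℕ
    edges : List (ℕ × ℕ)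

  E : ℕ
  E = length edges

  ends : Fin E → ℕ × ℕ
  ends = lookup edges

open Graph public

Joins : (G : Graph) → Fin (E G) → ℕ → ℕ → Set
Joins G e u w = (ends G e ≡ (u , w)) ⊎ (ends G e ≡ (w , u))

data Walk (G : Graph) (S : Subset (E G)) : ℕ → ℕ → List (Fin (E G)) → List ℕ → Set where
  stop : ∀ {u} → Walk G S u u [] []
  step : ∀ {u w v es vs} (e : Fin (E G)) → e ∈ₛ S → Joins G e u w →
         Walk G S w v es vs → Walk G S u v (e ∷ es) (u ∷ vs)

Connected : (G : Graph) → Subset (E G) → Set
Connected G S = (u v : Fin (V G)) →
  Σ (List (Fin (E G))) λ es → Σ (List ℕ) λ vs →
    Walk G S (Data.Fin.toℕ u) (Data.Fin.toℕ v) es vs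

HasCycle : (G : Graph) → Subset (E G) → Set
HasCycle G S = Σ ℕ λ u → Σ (List (Fin (E G))) λ es → Σ (List ℕ) λ vs →
  Walk G S u u es vs × (es ≢ []) × Unique es × Unique vs

IsSpanningTree : (G : Graph) → Subset (E G) → Set
IsSpanningTree G S = Connected G S × ¬ HasCycle G S

SpanningTreeCount : Graph → ℕ → Set
SpanningTreeCount G m = Σ (List (Subset (E G))) λ L →
  Unique L × (length L ≡ m) ×
  ((S : Subset (E G)) → (S ∈ L → IsSpanningTree G S) × (IsSpanningTree G S → S ∈ L))

record State : Set where
  constructor state
  field
    graphOf : Graph
    free    : List (ℕ × ℕ)

open State public

cycleEdges : ℕ → List (ℕ × ℕ)
cycleEdges k = map (λ i → (i , suc i)) (upTo (k ∸ 1)) ++ ((k ∸ 1 , 0) ∷ [])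

initial : ℕ → State
initial k = state (graph k (cycleEdges k)) (cycleEdges k)

pathEdges : ℕ → ℕ → ℕ → ℕ → List (ℕ × ℕ)
pathEdges r s v zero    = (r , s) ∷ []
pathEdges r s v (suc m) = (r , v) ∷ pathEdges v s (suc v) m

orient : Bool → ℕ × ℕ → ℕ × ℕ
orient false (r , s) = (r , s)
orient true  (r , s) = (s , r)

-- glue a new k-cycle onto the chosen free edge; the new nodes are
-- V, ..., V+k-3, and the new free edges are exactly the new path edges
-- (the edges incident to a new node)
grow : ℕ → (st : State) → Fin (length (free st)) → Bool → State
grow k st i b =
  let (r , s) = orient b (lookup (free st) i)
      G = graphOf st
      P = pathEdges r s (V G) (k ∸ 2)
  in state (graph (V G + (k ∸ 2)) (edges G ++ P)) P

data IsAccordion (k : ℕ) : ℕ → State → Set where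
  first : IsAccordion k 1 (initial k)
  next  : ∀ {n st} → IsAccordion k n st →
          (i : Fin (length (free st))) → (b : Bool) →
          IsAccordion k (suc n) (grow k st i b)

-- Glue a path of m + 1 edges (m = k - 2 new vertices) onto the ends r, s of an edge e₀ of G.  A spanning
-- tree of the new graph misses at most one path edge.  If it misses one, the rest is a spanning tree of G,
-- giving (m + 1)·a trees where a = τ(G); if it contains the whole path, the path plays the part of e₀, giving
-- the b spanning trees of G through e₀.  Each new path edge lies in m·a + b of the new trees.  So the pair
-- (τ, number of spanning trees through a free edge) evolves by (a , b) ↦ ((m + 1)·a + b , m·a + b) whatever
-- free edge is chosen, and eliminating b gives τₙ₊₂ = (m + 2)·τₙ₊₁ − τₙ.

module Submission where

open import Defs
open import Data.Bool using (Bool; true; false)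
open import Data.Empty using (⊥; ⊥-elim)
open import Data.Fin using (Fin; zero; suc; toℕ; fromℕ<)
open import Data.Fin.Properties using (toℕ-fromℕ<; toℕ<n; toℕ-injective) renaming (_≟_ to _≟ᶠ_)
import Data.Fin.Properties as Finₚ
open import Data.Fin.Subset using (Subset) renaming (_∈_ to _∈ₛ_)
open import Data.List using (List; []; _∷_; _++_; length; map; cartesianProduct; applyUpTo)
import Data.List as List
open import Data.List.Properties using (length-map; length-++)
open import Data.List.Membership.Propositional using (_∈_; _∉_)
open import Data.List.Membership.Propositional.Properties
  using (∈-++⁺ˡ; ∈-++⁺ʳ; ∈-++⁻; ∈-map⁺; ∈-map⁻; ∈-cartesianProduct⁺; ∈-cartesianProduct⁻)
open import Data.List.Relation.Unary.All as All using (All; []; _∷_)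
import Data.List.Relation.Unary.All.Properties as Allₚ
open import Data.List.Relation.Unary.AllPairs using ([]; _∷_)
open import Data.List.Relation.Unary.Any using (here; there)
open import Data.List.Relation.Unary.Unique.Propositional using (Unique)
import Data.List.Relation.Unary.Unique.Propositional.Properties as Uniqueₚ
open import Data.Nat using (ℕ; zero; suc; pred; _+_; _*_; _∸_; _≤_; _<_; z≤n; s≤s; _≟_; _<?_)
open import Data.Nat.Properties
open import Data.Nat.Tactic.RingSolver using (solve-∀)
open import Data.List.Membership.DecPropositional _≟_ using (_∈?_)
open import Data.Product using (Σ; _×_; _,_; proj₁; proj₂)
open import Data.Product.Properties using (,-injective)
open import Data.Sum using (_⊎_; inj₁; inj₂; [_,_]; map₁)
import Data.Sum as Sum
open import Data.Vec using (Vec; []; _∷_; lookup; replicate; _[_]≔_)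
open import Data.Vec.Properties
  using (∷-injectiveʳ; lookup∘update; lookup∘update′; []≔-idempotent; []≔-lookup; []=⇒lookup; lookup⇒[]=)
open import Function using (_∘_; id)
open import Relation.Binary using (tri<; tri≈; tri>)
open import Relation.Binary.Construct.Closure.ReflexiveTransitive
  using (Star; ε; _◅_; _◅◅_; return; reverse; fold; kleisliStar)
import Relation.Binary.Construct.Closure.ReflexiveTransitive as Star
open import Relation.Binary.PropositionalEquality hiding ([_])
open import Relation.Nullary using (¬_; yes; no)

-- Finite enumerations

-- SpanningTreeCount G unfolds to Count (IsSpanningTree G).
Count : {A : Set} → (A → Set) → ℕ → Set
Count {A} P m = Σ (List A) λ xs → Unique xs × length xs ≡ m ×
  ((x : A) → (x ∈ xs → P x) × (P x → x ∈ xs))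

module _ {A : Set} where

  count-resp : {P Q : A → Set} {m : ℕ} →
    (∀ x → P x → Q x) → (∀ x → Q x → P x) → Count P m → Count Q m
  count-resp P⇒Q Q⇒P (xs , uniq , len , enum) =
    xs , uniq , len , λ x → (P⇒Q x ∘ proj₁ (enum x)) , (proj₂ (enum x) ∘ Q⇒P x)

  count-∅ : {P : A → Set} → (∀ x → ¬ P x) → Count P 0
  count-∅ ¬P = [] , [] , refl , λ x → (λ ()) , (⊥-elim ∘ ¬P x)

  count-⊎ : {P Q : A → Set} {m n : ℕ} → (∀ x → P x → Q x → ⊥) →
    Count P m → Count Q n → Count (λ x → P x ⊎ Q x) (m + n)
  count-⊎ disj (xs , u , l , p) (ys , v , k , q) =
    xs ++ ys ,
    Uniqueₚ.++⁺ u v (λ (x∈xs , x∈ys) → disj _ (proj₁ (p _) x∈xs) (proj₁ (q _) x∈ys)) ,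
    trans (length-++ xs) (cong₂ _+_ l k) ,
    λ x → [ inj₁ ∘ proj₁ (p x) , inj₂ ∘ proj₁ (q x) ] ∘ ∈-++⁻ xs ,
          [ ∈-++⁺ˡ ∘ proj₂ (p x) , ∈-++⁺ʳ xs ∘ proj₂ (q x) ]

module _ {A B : Set} where

  unique-map-injectiveOn : (f : A → B) {xs : List A} →
    (∀ {x y} → x ∈ xs → y ∈ xs → f x ≡ f y → x ≡ y) → Unique xs → Unique (map f xs)
  unique-map-injectiveOn f {[]} inj [] = []
  unique-map-injectiveOn f {x ∷ xs} inj (x∉ ∷ u) =
    Allₚ.map⁺ (All.tabulate λ y∈ fx≡fy → All.lookup x∉ y∈ (inj (here refl) (there y∈) fx≡fy)) ∷
    unique-map-injectiveOn f (λ x∈ y∈ → inj (there x∈) (there y∈)) u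

  count-image : {P : A → Set} {m : ℕ} (f : A → B) →
    (∀ {x y} → P x → P y → f x ≡ f y → x ≡ y) →
    Count P m → Count (λ y → Σ A λ x → P x × f x ≡ y) m
  count-image f inj (xs , u , l , p) =
    map f xs ,
    unique-map-injectiveOn f (λ x∈ y∈ → inj (proj₁ (p _) x∈) (proj₁ (p _) y∈)) u ,
    trans (length-map f xs) l ,
    λ y → (λ y∈ → let x , x∈ , y≡fx = ∈-map⁻ f y∈ in x , proj₁ (p x) x∈ , sym y≡fx) ,
          λ { (x , px , refl) → ∈-map⁺ f (proj₂ (p x) px) }

  length-cartesianProduct : (xs : List A) (ys : List B) →
    length (cartesianProduct xs ys) ≡ length xs * length ys
  length-cartesianProduct [] ys = refl
  length-cartesianProduct (x ∷ xs) ys =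
    trans (length-++ (map (x ,_) ys)) (cong₂ _+_ (length-map _ ys) (length-cartesianProduct xs ys))

  count-× : {P : A → Set} {Q : B → Set} {m n : ℕ} →
    Count P m → Count Q n → Count (λ (x , y) → P x × Q y) (m * n)
  count-× (xs , u , l , p) (ys , v , k , q) =
    cartesianProduct xs ys ,
    Uniqueₚ.cartesianProduct⁺ u v ,
    trans (length-cartesianProduct xs ys) (cong₂ _*_ l k) ,
    λ (x , y) → (λ xy∈ → let x∈ , y∈ = ∈-cartesianProduct⁻ xs ys xy∈ in
                          proj₁ (p x) x∈ , proj₁ (q y) y∈) ,
                 λ (px , qy) → ∈-cartesianProduct⁺ (proj₂ (p x) px) (proj₂ (q y) qy)

-- Edge subsets as Boolean vectors

falses : ∀ {n} → Vec Bool n → ℕ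
falses [] = 0
falses (true ∷ v) = falses v
falses (false ∷ v) = suc (falses v)

count-∷ : ∀ {n m} {P : Vec Bool n → Set} (b : Bool) → Count P m →
  Count (λ w → Σ (Vec Bool n) λ v → P v × b ∷ v ≡ w) m
count-∷ b = count-image (b ∷_) (λ _ _ → ∷-injectiveʳ)

falses≡0⇒lookup≡true : ∀ {n} (v : Vec Bool n) → falses v ≡ 0 → ∀ j → lookup v j ≡ true
falses≡0⇒lookup≡true (true ∷ v) f≡0 zero = refl
falses≡0⇒lookup≡true (true ∷ v) f≡0 (suc j) = falses≡0⇒lookup≡true v f≡0 j

falses≡0⇒≡replicate : ∀ {n} (v : Vec Bool n) → falses v ≡ 0 → v ≡ replicate n true
falses≡0⇒≡replicate [] f≡0 = refl
falses≡0⇒≡replicate (true ∷ v) f≡0 = cong (true ∷_) (falses≡0⇒≡replicate v f≡0)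

falses-replicate : ∀ n → falses (replicate n true) ≡ 0
falses-replicate zero = refl
falses-replicate (suc n) = falses-replicate n

falses≡1⇒unique-false : ∀ {n} (v : Vec Bool n) → falses v ≡ 1 →
  Σ (Fin n) λ j → lookup v j ≡ false × (∀ i → i ≢ j → lookup v i ≡ true)
falses≡1⇒unique-false (true ∷ v) f≡1 =
  let j , vj≡false , others = falses≡1⇒unique-false v f≡1
  in suc j , vj≡false , λ { zero _ → refl ; (suc i) i≢j → others i (i≢j ∘ cong suc) }
falses≡1⇒unique-false (false ∷ v) f≡1 =
  zero , refl , λ { zero 0≢0 → ⊥-elim (0≢0 refl) ; (suc i) _ → falses≡0⇒lookup≡true v (suc-injective f≡1) i }

falses≥1⇒false : ∀ {n} (v : Vec Bool n) → 1 ≤ falses v → Σ (Fin n) λ j → lookup v j ≡ false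
falses≥1⇒false (true ∷ v) f≥1 = let j , vj≡false = falses≥1⇒false v f≥1 in suc j , vj≡false
falses≥1⇒false (false ∷ v) f≥1 = zero , refl

falses≥2⇒two-falses : ∀ {n} (v : Vec Bool n) → 2 ≤ falses v →
  Σ (Fin n) λ i → Σ (Fin n) λ j → toℕ i < toℕ j × lookup v i ≡ false × lookup v j ≡ false
falses≥2⇒two-falses (true ∷ v) f≥2 =
  let i , j , i<j , vi , vj = falses≥2⇒two-falses v f≥2 in suc i , suc j , s≤s i<j , vi , vj
falses≥2⇒two-falses (false ∷ v) (s≤s f≥1) =
  let j , vj = falses≥1⇒false v f≥1 in zero , suc j , s≤s z≤n , refl , vj

count-falses≡0 : ∀ n → Count (λ (v : Vec Bool n) → falses v ≡ 0) 1
count-falses≡0 zero = [] ∷ [] , [] ∷ [] , refl , λ { [] → (λ _ → refl) , (λ _ → here refl) }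
count-falses≡0 (suc n) = count-resp
  (λ { _ (v , f≡0 , refl) → f≡0 })
  (λ { (true ∷ v) f≡0 → v , f≡0 , refl ; (false ∷ v) () })
  (count-∷ true (count-falses≡0 n))

count-falses≡1 : ∀ n → Count (λ (v : Vec Bool n) → falses v ≡ 1) n
count-falses≡1 zero = count-∅ λ { [] () }
count-falses≡1 (suc n) = count-resp
  (λ { _ (inj₁ (v , f≡0 , refl)) → cong suc f≡0 ; _ (inj₂ (v , f≡1 , refl)) → f≡1 })
  (λ { (false ∷ v) f≡1 → inj₁ (v , suc-injective f≡1 , refl) ; (true ∷ v) f≡1 → inj₂ (v , f≡1 , refl) })
  (count-⊎ (λ { _ (_ , _ , refl) (_ , _ , ()) })
    (count-∷ false (count-falses≡0 n)) (count-∷ true (count-falses≡1 n)))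

count-falses≡1-true-at : ∀ n (j : Fin n) →
  Count (λ (v : Vec Bool n) → falses v ≡ 1 × lookup v j ≡ true) (pred n)
count-falses≡1-true-at (suc n) zero = count-resp
  (λ { _ (v , f≡1 , refl) → f≡1 , refl })
  (λ { (true ∷ v) (f≡1 , _) → v , f≡1 , refl })
  (count-∷ true (count-falses≡1 n))
count-falses≡1-true-at (suc (suc n)) (suc j) = count-resp
  (λ { _ (inj₁ (v , f≡0 , refl)) → cong suc f≡0 , falses≡0⇒lookup≡true v f≡0 j
     ; _ (inj₂ (v , f≡1 , refl)) → f≡1 })
  (λ { (false ∷ v) (f≡1 , _) → inj₁ (v , suc-injective f≡1 , refl)
     ; (true ∷ v) f≡1 → inj₂ (v , f≡1 , refl) })
  (count-⊎ (λ { _ (_ , _ , refl) (_ , _ , ()) })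
    (count-∷ false (count-falses≡0 (suc n))) (count-∷ true (count-falses≡1-true-at (suc n) j)))

-- Edges and edge subsets of a concatenated edge list

module _ {X : Set} where

  inˡ : (xs : List X) {ys : List X} → Fin (length xs) → Fin (length (xs ++ ys))
  inˡ (x ∷ xs) zero = zero
  inˡ (x ∷ xs) (suc i) = suc (inˡ xs i)

  inʳ : (xs : List X) {ys : List X} → Fin (length ys) → Fin (length (xs ++ ys))
  inʳ [] j = j
  inʳ (x ∷ xs) j = suc (inʳ xs j)

  data Split (xs ys : List X) : Fin (length (xs ++ ys)) → Set where
    left  : (i : Fin (length xs)) → Split xs ys (inˡ xs i)
    right : (j : Fin (length ys)) → Split xs ys (inʳ xs j)

  split : (xs ys : List X) (e : Fin (length (xs ++ ys))) → Split xs ys e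
  split [] ys e = right e
  split (x ∷ xs) ys zero = left zero
  split (x ∷ xs) ys (suc e) with split xs ys e
  ... | left i = left (suc i)
  ... | right j = right j

  inˡ-injective : (xs : List X) {ys : List X} {i i′ : Fin (length xs)} → inˡ xs {ys} i ≡ inˡ xs i′ → i ≡ i′
  inˡ-injective (x ∷ xs) {i = zero} {zero} _ = refl
  inˡ-injective (x ∷ xs) {i = suc i} {suc i′} eq = cong suc (inˡ-injective xs (Finₚ.suc-injective eq))

  inʳ-injective : (xs : List X) {ys : List X} {j j′ : Fin (length ys)} → inʳ xs {ys} j ≡ inʳ xs j′ → j ≡ j′
  inʳ-injective [] eq = eq
  inʳ-injective (x ∷ xs) eq = inʳ-injective xs (Finₚ.suc-injective eq)

  inˡ≢inʳ : (xs : List X) {ys : List X} (i : Fin (length xs)) (j : Fin (length ys)) → inˡ xs {ys} i ≢ inʳ xs j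
  inˡ≢inʳ (x ∷ xs) (suc i) j eq = inˡ≢inʳ xs i j (Finₚ.suc-injective eq)

  lookup-inˡ : (xs : List X) {ys : List X} (i : Fin (length xs)) → List.lookup (xs ++ ys) (inˡ xs i) ≡ List.lookup xs i
  lookup-inˡ (x ∷ xs) zero = refl
  lookup-inˡ (x ∷ xs) (suc i) = lookup-inˡ xs i

  lookup-inʳ : (xs : List X) {ys : List X} (j : Fin (length ys)) → List.lookup (xs ++ ys) (inʳ xs j) ≡ List.lookup ys j
  lookup-inʳ [] j = refl
  lookup-inʳ (x ∷ xs) j = lookup-inʳ xs j

  joinˢ : (xs : List X) {ys : List X} → Vec Bool (length xs) → Vec Bool (length ys) → Vec Bool (length (xs ++ ys))
  joinˢ [] [] T = T
  joinˢ (x ∷ xs) (b ∷ S) T = b ∷ joinˢ xs S T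

  leftˢ : (xs : List X) {ys : List X} → Vec Bool (length (xs ++ ys)) → Vec Bool (length xs)
  leftˢ [] S′ = []
  leftˢ (x ∷ xs) (b ∷ S′) = b ∷ leftˢ xs S′

  rightˢ : (xs : List X) {ys : List X} → Vec Bool (length (xs ++ ys)) → Vec Bool (length ys)
  rightˢ [] S′ = S′
  rightˢ (x ∷ xs) (b ∷ S′) = rightˢ xs S′

  joinˢ-leftˢ-rightˢ : (xs : List X) {ys : List X} (S′ : Vec Bool (length (xs ++ ys))) →
    joinˢ xs (leftˢ xs S′) (rightˢ xs S′) ≡ S′
  joinˢ-leftˢ-rightˢ [] S′ = refl
  joinˢ-leftˢ-rightˢ (x ∷ xs) (b ∷ S′) = cong (b ∷_) (joinˢ-leftˢ-rightˢ xs S′)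

  leftˢ-joinˢ : (xs : List X) {ys : List X} (S : Vec Bool (length xs)) (T : Vec Bool (length ys)) →
    leftˢ xs {ys} (joinˢ xs S T) ≡ S
  leftˢ-joinˢ [] [] T = refl
  leftˢ-joinˢ (x ∷ xs) (b ∷ S) T = cong (b ∷_) (leftˢ-joinˢ xs S T)

  rightˢ-joinˢ : (xs : List X) {ys : List X} (S : Vec Bool (length xs)) (T : Vec Bool (length ys)) →
    rightˢ xs {ys} (joinˢ xs S T) ≡ T
  rightˢ-joinˢ [] [] T = refl
  rightˢ-joinˢ (x ∷ xs) (b ∷ S) T = rightˢ-joinˢ xs S T

  joinˢ-injective : (xs : List X) {ys : List X} {S S₁ : Vec Bool (length xs)} {T T₁ : Vec Bool (length ys)} →
    joinˢ xs S T ≡ joinˢ xs S₁ T₁ → (S , T) ≡ (S₁ , T₁)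
  joinˢ-injective xs {ys} {S} {S₁} {T} {T₁} eq = cong₂ _,_
    (trans (sym (leftˢ-joinˢ xs S T)) (trans (cong (leftˢ xs) eq) (leftˢ-joinˢ xs S₁ T₁)))
    (trans (sym (rightˢ-joinˢ xs {ys} S T)) (trans (cong (rightˢ xs) eq) (rightˢ-joinˢ xs S₁ T₁)))

  lookup-joinˢ-inˡ : (xs : List X) {ys : List X} (S : Vec Bool (length xs)) (T : Vec Bool (length ys))
    (i : Fin (length xs)) → lookup (joinˢ xs {ys} S T) (inˡ xs i) ≡ lookup S i
  lookup-joinˢ-inˡ (x ∷ xs) (b ∷ S) T zero = refl
  lookup-joinˢ-inˡ (x ∷ xs) (b ∷ S) T (suc i) = lookup-joinˢ-inˡ xs S T i

  lookup-joinˢ-inʳ : (xs : List X) {ys : List X} (S : Vec Bool (length xs)) (T : Vec Bool (length ys))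
    (j : Fin (length ys)) → lookup (joinˢ xs {ys} S T) (inʳ xs j) ≡ lookup T j
  lookup-joinˢ-inʳ [] [] T j = refl
  lookup-joinˢ-inʳ (x ∷ xs) (b ∷ S) T j = lookup-joinˢ-inʳ xs S T j

  lookup-inʳ-rightˢ : (xs : List X) {ys : List X} (S′ : Vec Bool (length (xs ++ ys))) (j : Fin (length ys)) →
    lookup S′ (inʳ xs j) ≡ lookup (rightˢ xs S′) j
  lookup-inʳ-rightˢ [] S′ j = refl
  lookup-inʳ-rightˢ (x ∷ xs) (b ∷ S′) j = lookup-inʳ-rightˢ xs S′ j

-- Reachability and spanning trees

In : ∀ {n} → Vec Bool n → Fin n → Set
In S e = lookup S e ≡ true

false⇒¬In : ∀ {n} {S : Vec Bool n} {e} → lookup S e ≡ false → ¬ In S e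
false⇒¬In Se≡false Se≡true with () ← trans (sym Se≡true) Se≡false

record Adjacent (G : Graph) (P : Fin (E G) → Set) (u w : ℕ) : Set where
  constructor adj
  field
    edge : Fin (E G)
    present : P edge
    joins : Joins G edge u w

Reach : (G : Graph) → (Fin (E G) → Set) → ℕ → ℕ → Set
Reach G P = Star (Adjacent G P)

module _ {G : Graph} where

  joins-sym : ∀ {e u w} → Joins G e u w → Joins G e w u
  joins-sym (inj₁ eq) = inj₂ eq
  joins-sym (inj₂ eq) = inj₁ eq

  edge-reach : ∀ {P e u w} → P e → Joins G e u w → Reach G P u w
  edge-reach pe j = return (adj _ pe j)

  reach-sym : ∀ {P u v} → Reach G P u v → Reach G P v u
  reach-sym = reverse λ (adj e pe j) → adj e pe (joins-sym j)

  reach-mono : ∀ {P Q : Fin (E G) → Set} {u v} → (∀ e → P e → Q e) → Reach G P u v → Reach G Q u v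
  reach-mono P⇒Q = Star.map λ (adj e pe j) → adj e (P⇒Q e pe) j

  reach-closed : ∀ {P : Fin (E G) → Set} (X : ℕ → Set) → (∀ e a b → P e → Joins G e a b → X a → X b) →
    ∀ {u v} → Reach G P u v → X u → X v
  reach-closed X closed = fold (λ a b → X a → X b) (λ (adj e pe j) Xb→Xc → Xb→Xc ∘ closed e _ _ pe j) id

  same-ends : ∀ {e u w a b} → Joins G e u w → Joins G e a b → (u ≡ a × w ≡ b) ⊎ (u ≡ b × w ≡ a)
  same-ends (inj₁ x) (inj₁ y) = inj₁ (,-injective (trans (sym x) y))
  same-ends (inj₁ x) (inj₂ y) = inj₂ (,-injective (trans (sym x) y))
  same-ends (inj₂ x) (inj₁ y) = let w≡a , u≡b = ,-injective (trans (sym x) y) in inj₂ (u≡b , w≡a)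
  same-ends (inj₂ x) (inj₂ y) = let w≡b , u≡a = ,-injective (trans (sym x) y) in inj₁ (u≡a , w≡b)

reach-resp-ends : ∀ {G H : Graph} {Q : Fin (E H) → Set} {e u w a b} →
  Joins G e u w → Joins G e a b → Reach H Q u w → Reach H Q a b
reach-resp-ends {G} j j′ uw with same-ends {G} j j′
... | inj₁ (refl , refl) = uw
... | inj₂ (refl , refl) = reach-sym uw

reach-map : (G H : Graph) {P : Fin (E G) → Set} {Q : Fin (E H) → Set} (f : ℕ → ℕ) →
  (∀ e a b → P e → Joins G e a b → Reach H Q (f a) (f b)) →
  ∀ {u v} → Reach G P u v → Reach H Q (f u) (f v)
reach-map G H f edge = kleisliStar f λ (adj e pe j) → edge e _ _ pe j

ReachConnected : (G : Graph) → (Fin (E G) → Set) → Set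
ReachConnected G P = (u v : Fin (V G)) → Reach G P (toℕ u) (toℕ v)

connected-at : ∀ {G P} → ReachConnected G P → ∀ {x y} → x < V G → y < V G → Reach G P x y
connected-at {G} {P} conn x<V y<V =
  subst₂ (Reach G P) (toℕ-fromℕ< x<V) (toℕ-fromℕ< y<V) (conn (fromℕ< x<V) (fromℕ< y<V))

Without : ∀ {n} → (Fin n → Set) → Fin n → Fin n → Set
Without P f e = P e × e ≢ f

CycleEdge : (G : Graph) → (Fin (E G) → Set) → Set
CycleEdge G P = Σ (Fin (E G)) λ f → P f × Σ ℕ λ u → Σ ℕ λ w → Joins G f u w × Reach G (Without P f) w u

IsTree : (G : Graph) → (Fin (E G) → Set) → Set
IsTree G P = ReachConnected G P × ¬ CycleEdge G P

module _ {G : Graph} where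

  data PWalk (P : Fin (E G) → Set) : ℕ → ℕ → List (Fin (E G)) → List ℕ → Set where
    stop : ∀ {u} → PWalk P u u [] []
    step : ∀ {u w v es vs} (e : Fin (E G)) → P e → Joins G e u w →
           PWalk P w v es vs → PWalk P u v (e ∷ es) (u ∷ vs)

  SimpleWalk : (Fin (E G) → Set) → ℕ → ℕ → Set
  SimpleWalk P u v = Σ (List (Fin (E G))) λ es → Σ (List ℕ) λ vs → PWalk P u v es vs × Unique vs × v ∉ vs

  drop-until : ∀ {P w v es vs u} → PWalk P w v es vs → u ∈ vs → Unique vs →
    Σ (List (Fin (E G))) λ es′ → Σ (List ℕ) λ vs′ →
      PWalk P u v es′ vs′ × Unique vs′ × (∀ {x} → x ∈ vs′ → x ∈ vs)
  drop-until (step e pe j p) (here refl) uniq = _ , _ , step e pe j p , uniq , id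
  drop-until (step e pe j p) (there u∈) (_ ∷ uniq) =
    let es′ , vs′ , p′ , uniq′ , ⊆vs = drop-until p u∈ uniq in es′ , vs′ , p′ , uniq′ , there ∘ ⊆vs

  simple-walk : ∀ {P u v} → Reach G P u v → SimpleWalk P u v
  simple-walk ε = [] , [] , stop , [] , λ ()
  simple-walk {u = u} {v} ((adj e pe j) ◅ r) with simple-walk r | u ≟ v
  ... | _ | yes refl = [] , [] , stop , [] , λ ()
  ... | es , vs , p , uniq , v∉ | no u≢v with u ∈? vs
  ...   | yes u∈ = let es′ , vs′ , p′ , uniq′ , ⊆vs = drop-until p u∈ uniq
                   in es′ , vs′ , p′ , uniq′ , v∉ ∘ ⊆vs
  ...   | no u∉ = e ∷ es , u ∷ vs , step e pe j p ,
                  All.tabulate (λ x∈ u≡x → u∉ (subst (_∈ vs) (sym u≡x) x∈)) ∷ uniq ,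
                  λ { (here v≡u) → u≢v (sym v≡u) ; (there v∈) → v∉ v∈ }

  start∈ : ∀ {P w v es vs} → PWalk P w v es vs → w ∈ vs ⊎ w ≡ v
  start∈ stop = inj₂ refl
  start∈ (step e pe j p) = inj₁ (here refl)

  edge-endpoints : ∀ {P u v es vs e} → PWalk P u v es vs → e ∈ es →
    Σ ℕ λ a → Σ ℕ λ b → Joins G e a b × a ∈ vs × (b ∈ vs ⊎ b ≡ v)
  edge-endpoints (step e pe j p) (here refl) = _ , _ , j , here refl , map₁ there (start∈ p)
  edge-endpoints (step e pe j p) (there e∈) =
    let a , b , j′ , a∈ , b∈ = edge-endpoints p e∈ in a , b , j′ , there a∈ , map₁ there b∈

  -- an edge occurring twice would revisit its start vertex, or end at the final vertex
  unique-edges : ∀ {P u v es vs} → PWalk P u v es vs → Unique vs → v ∉ vs → Unique es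
  unique-edges stop _ _ = []
  unique-edges (step e pe j p) (u∉ ∷ uniq) v∉ =
    All.tabulate (λ e∈ e≡ → repeated (subst (_∈ _) (sym e≡) e∈)) ∷ unique-edges p uniq (v∉ ∘ there)
    where
    repeated : e ∈ _ → ⊥
    repeated e∈ with edge-endpoints p e∈
    ... | a , b , j′ , a∈ , b∈ with same-ends {G} j′ j
    ...   | inj₁ (refl , _) = All.lookup u∉ a∈ refl
    ...   | inj₂ (_ , refl) = [ (λ b∈vs → All.lookup u∉ b∈vs refl) , (λ b≡v → v∉ (here (sym b≡v))) ] b∈

  avoids : ∀ {P f u v es vs} → PWalk (Without P f) u v es vs → All (f ≢_) es
  avoids stop = []
  avoids (step e (pe , e≢f) j p) = (e≢f ∘ sym) ∷ avoids p

  PWalk⇒Walk : ∀ {P S u v es vs} → (∀ e → P e → e ∈ₛ S) → PWalk P u v es vs → Walk G S u v es vs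
  PWalk⇒Walk P⊆S stop = stop
  PWalk⇒Walk P⊆S (step e pe j p) = step e (P⊆S e pe) j (PWalk⇒Walk P⊆S p)

module _ {G : Graph} {S : Subset (E G)} where

  walk⇒reach : ∀ {u v es vs} → Walk G S u v es vs → Reach G (In S) u v
  walk⇒reach stop = ε
  walk⇒reach (step e e∈ j w) = adj e ([]=⇒lookup e∈) j ◅ walk⇒reach w

  reach⇒walk : ∀ {u v} → Reach G (In S) u v → Σ (List (Fin (E G))) λ es → Σ (List ℕ) λ vs → Walk G S u v es vs
  reach⇒walk ε = [] , [] , stop
  reach⇒walk ((adj e pe j) ◅ r) = let es , vs , w = reach⇒walk r in e ∷ es , _ , step e (lookup⇒[]= e S pe) j w

  walk-avoiding⇒reach : ∀ {f u v es vs} → Walk G S u v es vs → All (f ≢_) es → Reach G (Without (In S) f) u v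
  walk-avoiding⇒reach stop _ = ε
  walk-avoiding⇒reach (step e e∈ j w) (f≢e ∷ avoid) =
    adj e ([]=⇒lookup e∈ , f≢e ∘ sym) j ◅ walk-avoiding⇒reach w avoid

  hasCycle⇒cycleEdge : HasCycle G S → CycleEdge G (In S)
  hasCycle⇒cycleEdge (u , [] , [] , stop , es≢[] , _ , _) = ⊥-elim (es≢[] refl)
  hasCycle⇒cycleEdge (u , _ , _ , step {w = w} e e∈ j rest , _ , (e∉ ∷ _) , _) =
    e , []=⇒lookup e∈ , u , w , j , walk-avoiding⇒reach rest e∉

  cycleEdge⇒hasCycle : CycleEdge G (In S) → HasCycle G S
  cycleEdge⇒hasCycle (f , pf , u , w , j , r) =
    let es , vs , p , uniq , u∉ = simple-walk r in
    u , f ∷ es , u ∷ vs ,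
    step f (lookup⇒[]= f S pf) j (PWalk⇒Walk (λ e pe → lookup⇒[]= e S (proj₁ pe)) p) ,
    (λ ()) , avoids p ∷ unique-edges p uniq u∉ ,
    All.tabulate (λ x∈ u≡x → u∉ (subst (_∈ vs) (sym u≡x) x∈)) ∷ uniq

  isSpanningTree⇒isTree : IsSpanningTree G S → IsTree G (In S)
  isSpanningTree⇒isTree (conn , acyclic) =
    (λ u v → walk⇒reach (proj₂ (proj₂ (conn u v)))) , acyclic ∘ cycleEdge⇒hasCycle

  isTree⇒isSpanningTree : IsTree G (In S) → IsSpanningTree G S
  isTree⇒isSpanningTree (conn , acyclic) = (λ u v → reach⇒walk (conn u v)) , acyclic ∘ hasCycle⇒cycleEdge

TreeCount : Graph → ℕ → Set
TreeCount G = Count λ S → IsTree G (In S)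

-- Gluing a path onto a graph

-- vertex i of the path  r - v - (v+1) - ... - (v+m-1) - s  built by pathEdges r s v m
pathVertex : ℕ → ℕ → ℕ → ℕ → ℕ → ℕ
pathVertex r s v m zero = r
pathVertex r s v zero (suc i) = s
pathVertex r s v (suc m) (suc i) = pathVertex v s (suc v) m i

pathVertex-inner : ∀ r s v m i → i < m → pathVertex r s v m (suc i) ≡ v + i
pathVertex-inner r s v (suc m) zero _ = sym (+-identityʳ v)
pathVertex-inner r s v (suc m) (suc i) (s≤s i<m) = trans (pathVertex-inner v s (suc v) m i i<m) (sym (+-suc v i))

pathVertex-last : ∀ r s v m i → m ≤ i → pathVertex r s v m (suc i) ≡ s
pathVertex-last r s v zero i _ = refl
pathVertex-last r s v (suc m) (suc i) (s≤s m≤i) = pathVertex-last v s (suc v) m i m≤i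

lookup-pathEdges : ∀ r s v m (j : Fin (length (pathEdges r s v m))) →
  List.lookup (pathEdges r s v m) j ≡ (pathVertex r s v m (toℕ j) , pathVertex r s v m (suc (toℕ j)))
lookup-pathEdges r s v zero zero = refl
lookup-pathEdges r s v (suc m) zero = refl
lookup-pathEdges r s v (suc m) (suc j) = lookup-pathEdges v s (suc v) m j

length-pathEdges : ∀ r s v m → length (pathEdges r s v m) ≡ suc m
length-pathEdges r s v zero = refl
length-pathEdges r s v (suc m) = cong suc (length-pathEdges v s (suc v) m)

WellFormed : Graph → Set
WellFormed G = ∀ e → proj₁ (ends G e) < V G × proj₂ (ends G e) < V G

joins-vertices : ∀ {G} → WellFormed G → ∀ {e a b} → Joins G e a b → a < V G × b < V G
joins-vertices {G} wf {e} (inj₁ refl) = wf e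
joins-vertices {G} wf {e} (inj₂ refl) = let a<V , b<V = wf e in b<V , a<V

-- G′ is G with the path  r - V₀ - ... - (V₀+m-1) - s  glued on; path edge j joins path vertices j and j+1.
module Extension (G : Graph) (wf : WellFormed G) (r s : ℕ) (r<V : r < V G) (s<V : s < V G) (m : ℕ) where

  V₀ : ℕ
  V₀ = V G

  xs : List (ℕ × ℕ)
  xs = edges G

  P : List (ℕ × ℕ)
  P = pathEdges r s V₀ m

  G′ : Graph
  G′ = graph (V₀ + m) (xs ++ P)

  vertex : ℕ → ℕ
  vertex = pathVertex r s V₀ m

  vertex-last : vertex (suc m) ≡ s
  vertex-last = pathVertex-last r s V₀ m m ≤-refl

  old<V′ : ∀ {x} → x < V₀ → x < V₀ + m
  old<V′ x<V₀ = <-≤-trans x<V₀ (m≤m+n V₀ m)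

  path-index≤m : ∀ (j : Fin (length P)) → toℕ j ≤ m
  path-index≤m j = ≤-pred (subst (toℕ j <_) (length-pathEdges r s V₀ m) (toℕ<n j))

  path-index : ∀ t → t < suc m → Σ (Fin (length P)) λ j → toℕ j ≡ t
  path-index t t≤m = fromℕ< (subst (t <_) (sym (length-pathEdges r s V₀ m)) t≤m) , toℕ-fromℕ< _

  joins-old⁻ : ∀ i {a b} → Joins G′ (inˡ xs i) a b → Joins G i a b
  joins-old⁻ i = Sum.map (trans (sym (lookup-inˡ xs i))) (trans (sym (lookup-inˡ xs i)))

  joins-old⁺ : ∀ i {a b} → Joins G i a b → Joins G′ (inˡ xs i) a b
  joins-old⁺ i = Sum.map (trans (lookup-inˡ xs i)) (trans (lookup-inˡ xs i))

  ends-path : ∀ j → ends G′ (inʳ xs j) ≡ (vertex (toℕ j) , vertex (suc (toℕ j)))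
  ends-path j = trans (lookup-inʳ xs j) (lookup-pathEdges r s V₀ m j)

  joins-path : ∀ j → Joins G′ (inʳ xs j) (vertex (toℕ j)) (vertex (suc (toℕ j)))
  joins-path j = inj₁ (ends-path j)

  joins-path⁻ : ∀ j {a b} → Joins G′ (inʳ xs j) a b →
    (a ≡ vertex (toℕ j) × b ≡ vertex (suc (toℕ j))) ⊎ (a ≡ vertex (suc (toℕ j)) × b ≡ vertex (toℕ j))
  joins-path⁻ j (inj₁ eq) = inj₁ (,-injective (trans (sym eq) (ends-path j)))
  joins-path⁻ j (inj₂ eq) = let b≡ , a≡ = ,-injective (trans (sym eq) (ends-path j)) in inj₂ (a≡ , b≡)

  vertex<V′ : ∀ i → i ≤ suc m → vertex i < V₀ + m
  vertex<V′ zero _ = old<V′ r<V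
  vertex<V′ (suc i) _ with i <? m
  ... | yes i<m = subst (_< V₀ + m) (sym (pathVertex-inner r s V₀ m i i<m)) (+-monoʳ-< V₀ i<m)
  ... | no i≮m = subst (_< V₀ + m) (sym (pathVertex-last r s V₀ m i (≮⇒≥ i≮m))) (old<V′ s<V)

  wellFormed′ : WellFormed G′
  wellFormed′ e with split xs P e
  ... | left i = subst (λ (a , b) → a < V₀ + m × b < V₀ + m) (sym (lookup-inˡ xs i))
                   (let a<V , b<V = wf i in old<V′ a<V , old<V′ b<V)
  ... | right j = subst (λ (a , b) → a < V₀ + m × b < V₀ + m) (sym (ends-path j))
                    (vertex<V′ (toℕ j) (m≤n⇒m≤1+n (path-index≤m j)) ,
                     vertex<V′ (suc (toℕ j)) (s≤s (path-index≤m j)))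

  -- collapse c maps the path vertices 1 .. c to r and the later ones to s
  collapse : ℕ → ℕ → ℕ
  collapse c x with x <? V₀
  ... | yes _ = x
  ... | no _ with x <? V₀ + c
  ...   | yes _ = r
  ...   | no _ = s

  collapse-old : ∀ c x → x < V₀ → collapse c x ≡ x
  collapse-old c x x<V₀ with x <? V₀
  ... | yes _ = refl
  ... | no x≮V₀ = ⊥-elim (x≮V₀ x<V₀)

  collapse-before : ∀ c x → V₀ ≤ x → x < V₀ + c → collapse c x ≡ r
  collapse-before c x V₀≤x x<V₀+c with x <? V₀
  ... | yes x<V₀ = ⊥-elim (<⇒≱ x<V₀ V₀≤x)
  ... | no _ with x <? V₀ + c
  ...   | yes _ = refl
  ...   | no x≮ = ⊥-elim (x≮ x<V₀+c)

  collapse-after : ∀ c x → V₀ + c ≤ x → collapse c x ≡ s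
  collapse-after c x V₀+c≤x with x <? V₀
  ... | yes x<V₀ = ⊥-elim (<⇒≱ x<V₀ (≤-trans (m≤m+n V₀ c) V₀+c≤x))
  ... | no _ with x <? V₀ + c
  ...   | yes x< = ⊥-elim (<⇒≱ x< V₀+c≤x)
  ...   | no _ = refl

  collapse-vertex≤ : ∀ c i → c ≤ m → i ≤ c → collapse c (vertex i) ≡ r
  collapse-vertex≤ c zero _ _ = collapse-old c r r<V
  collapse-vertex≤ c (suc i) c≤m i<c =
    trans (cong (collapse c) (pathVertex-inner r s V₀ m i (<-≤-trans i<c c≤m)))
          (collapse-before c (V₀ + i) (m≤m+n V₀ i) (+-monoʳ-< V₀ i<c))

  collapse-vertex> : ∀ c i → i ≤ suc m → c < i → collapse c (vertex i) ≡ s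
  collapse-vertex> c (suc i) _ (s≤s c≤i) with i <? m
  ... | yes i<m = trans (cong (collapse c) (pathVertex-inner r s V₀ m i i<m))
                        (collapse-after c (V₀ + i) (+-monoʳ-≤ V₀ c≤i))
  ... | no i≮m = trans (cong (collapse c) (pathVertex-last r s V₀ m i (≮⇒≥ i≮m))) (collapse-old c s s<V)

  -- Collapsing turns a reach in G′ into one in G, provided path edge c is unused or can be replaced by an r–s reach.
  module Collapse {Q : Fin (E G′) → Set} {R : Fin (E G) → Set} (c : ℕ) (c≤m : c ≤ m)
    (old : ∀ i → Q (inˡ xs i) → R i)
    (cut : ∀ j → toℕ j ≡ c → Q (inʳ xs j) → Reach G R r s) where

    collapse-path-edge : ∀ j → Q (inʳ xs j) →
      Reach G R (collapse c (vertex (toℕ j))) (collapse c (vertex (suc (toℕ j))))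
    collapse-path-edge j q with <-cmp (toℕ j) c
    ... | tri< j<c _ _ = subst₂ (Reach G R) (sym (collapse-vertex≤ c (toℕ j) c≤m (<⇒≤ j<c)))
                           (sym (collapse-vertex≤ c _ c≤m j<c)) ε
    ... | tri≈ _ j≡c _ = subst₂ (Reach G R) (sym (collapse-vertex≤ c (toℕ j) c≤m (≤-reflexive j≡c)))
                           (sym (collapse-vertex> c _ (s≤s (path-index≤m j)) (s≤s (≤-reflexive (sym j≡c)))))
                           (cut j j≡c q)
    ... | tri> _ _ c<j = subst₂ (Reach G R) (sym (collapse-vertex> c (toℕ j) (m≤n⇒m≤1+n (path-index≤m j)) c<j))
                           (sym (collapse-vertex> c _ (s≤s (path-index≤m j)) (m<n⇒m<1+n c<j))) ε

    collapse-edge : ∀ e a b → Q e → Joins G′ e a b → Reach G R (collapse c a) (collapse c b)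
    collapse-edge e a b q jn with split xs P e
    ... | left i = let jG = joins-old⁻ i jn ; a<V , b<V = joins-vertices {G} wf jG in
                   subst₂ (Reach G R) (sym (collapse-old c a a<V)) (sym (collapse-old c b b<V)) (edge-reach (old i q) jG)
    ... | right j with joins-path⁻ j jn
    ...   | inj₁ (refl , refl) = collapse-path-edge j q
    ...   | inj₂ (refl , refl) = reach-sym (collapse-path-edge j q)

    collapse-reach : ∀ {u v} → Reach G′ Q u v → Reach G R (collapse c u) (collapse c v)
    collapse-reach = reach-map G′ G (collapse c) collapse-edge

  path-segment : ∀ {Q : Fin (E G′) → Set} i d → i + d ≤ suc m →
    (∀ j → i ≤ toℕ j → toℕ j < i + d → Q (inʳ xs j)) → Reach G′ Q (vertex i) (vertex (i + d))
  path-segment {Q} i zero _ _ = subst (λ z → Reach G′ Q (vertex i) (vertex z)) (sym (+-identityʳ i)) ε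
  path-segment {Q} i (suc d) bound present with path-index (i + d) (subst (_≤ suc m) (+-suc i d) bound)
  ... | j , j≡i+d = subst (λ z → Reach G′ Q (vertex i) (vertex z)) (sym (+-suc i d))
      (path-segment i d (≤-trans (+-monoʳ-≤ i (n≤1+n d)) bound)
                    (λ j′ i≤j′ j′<i+d → present j′ i≤j′ (<-trans j′<i+d (+-monoʳ-< i (n<1+n d))))
       ◅◅ edge-reach (present j (subst (i ≤_) (sym j≡i+d) (m≤m+n i d))
                                (subst (_< i + suc d) (sym j≡i+d) (+-monoʳ-< i (n<1+n d))))
                     (subst (λ z → Joins G′ (inʳ xs j) (vertex z) (vertex (suc z))) j≡i+d (joins-path j)))

  path-reach : ∀ {Q : Fin (E G′) → Set} → (∀ j → Q (inʳ xs j)) → Reach G′ Q r s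
  path-reach {Q} present = subst (Reach G′ Q r) vertex-last (path-segment 0 (suc m) ≤-refl (λ j _ _ → present j))

  new-vertex : ∀ {x} → ¬ x < V₀ → x < V₀ + m → Σ ℕ λ t → t < m × vertex (suc t) ≡ x
  new-vertex {x} x≮V₀ x<V′ = x ∸ V₀ , t<m , trans (pathVertex-inner r s V₀ m (x ∸ V₀) t<m) V₀+t≡x
    where
    V₀+t≡x : V₀ + (x ∸ V₀) ≡ x
    V₀+t≡x = m+[n∸m]≡n (≮⇒≥ x≮V₀)
    t<m : x ∸ V₀ < m
    t<m = +-cancelˡ-< V₀ (x ∸ V₀) m (subst (_< V₀ + m) (sym V₀+t≡x) x<V′)

  -- go back to r before the missing path edge c, and on to s after it
  reach-old-vertex : ∀ {Q : Fin (E G′) → Set} c → (∀ j → toℕ j ≢ c → Q (inʳ xs j)) →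
    ∀ x → x < V₀ + m → Σ ℕ λ y → y < V₀ × Reach G′ Q x y
  reach-old-vertex {Q} c present x x<V′ with x <? V₀
  ... | yes x<V₀ = x , x<V₀ , ε
  ... | no x≮V₀ with new-vertex x≮V₀ x<V′
  ...   | t , t<m , refl with t <? c
  ...     | yes t<c = r , r<V , reach-sym
                        (path-segment 0 (suc t) (s≤s (<⇒≤ t<m))
                          λ j _ j≤t → present j (<⇒≢ (<-≤-trans j≤t t<c)))
  ...     | no t≮c = s , s<V , subst (Reach G′ Q _) vertex≡s
                       (path-segment (suc t) (m ∸ t) (s≤s (≤-reflexive t+[m∸t]≡m))
                         λ j t<j _ → present j λ j≡c → <⇒≱ (s≤s (≮⇒≥ t≮c)) (subst (suc t ≤_) j≡c t<j))
    where
    t+[m∸t]≡m : t + (m ∸ t) ≡ m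
    t+[m∸t]≡m = m+[n∸m]≡n (<⇒≤ t<m)
    vertex≡s : vertex (suc t + (m ∸ t)) ≡ s
    vertex≡s = pathVertex-last r s V₀ m (t + (m ∸ t)) (≤-reflexive (sym t+[m∸t]≡m))

  -- the new vertices strictly after path vertex c₁ and up to path vertex c₂
  Between : ℕ → ℕ → ℕ → Set
  Between c₁ c₂ x = V₀ + c₁ ≤ x × x < V₀ + c₂

  vertex-between : ∀ c₁ c₂ i → c₂ ≤ m → c₁ < i → i ≤ c₂ → Between c₁ c₂ (vertex i)
  vertex-between c₁ c₂ (suc i) c₂≤m (s≤s c₁≤i) i<c₂ =
    subst (Between c₁ c₂) (sym (pathVertex-inner r s V₀ m i (<-≤-trans i<c₂ c₂≤m)))
      (+-monoʳ-≤ V₀ c₁≤i , +-monoʳ-< V₀ i<c₂)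

  vertex-not-between : ∀ c₁ c₂ i → i ≤ suc m → i ≤ c₁ ⊎ c₂ < i → ¬ Between c₁ c₂ (vertex i)
  vertex-not-between c₁ c₂ zero _ _ (V₀+c₁≤r , _) = <⇒≱ r<V (≤-trans (m≤m+n V₀ c₁) V₀+c₁≤r)
  vertex-not-between c₁ c₂ (suc i) _ outside (lower , upper) with i <? m
  ... | yes i<m rewrite pathVertex-inner r s V₀ m i i<m =
        [ (λ i<c₁ → <⇒≱ (+-monoʳ-< V₀ i<c₁) lower)
        , (λ c₂<i+1 → <⇒≱ upper (+-monoʳ-≤ V₀ (≤-pred c₂<i+1))) ] outside
  ... | no i≮m rewrite pathVertex-last r s V₀ m i (≮⇒≥ i≮m) = <⇒≱ s<V (≤-trans (m≤m+n V₀ c₁) lower)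

  -- Without path edges c₁ and c₂ nothing leaves the path segment strictly between them.
  module Isolated {Q : Fin (E G′) → Set} (c₁ c₂ : ℕ) (c₁<c₂ : c₁ < c₂) (c₂≤m : c₂ ≤ m)
    (absent₁ : ∀ j → toℕ j ≡ c₁ → ¬ Q (inʳ xs j))
    (absent₂ : ∀ j → toℕ j ≡ c₂ → ¬ Q (inʳ xs j)) where

    forward : ∀ j → Q (inʳ xs j) → Between c₁ c₂ (vertex (toℕ j)) → Between c₁ c₂ (vertex (suc (toℕ j)))
    forward j q inside with <-cmp (toℕ j) c₁ | <-cmp (toℕ j) c₂
    ... | tri< j<c₁ _ _ | _ =
      ⊥-elim (vertex-not-between c₁ c₂ _ (m≤n⇒m≤1+n (path-index≤m j)) (inj₁ (<⇒≤ j<c₁)) inside)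
    ... | tri≈ _ j≡c₁ _ | _ = ⊥-elim (absent₁ j j≡c₁ q)
    ... | tri> _ _ c₁<j | tri< j<c₂ _ _ = vertex-between c₁ c₂ _ c₂≤m (m<n⇒m<1+n c₁<j) j<c₂
    ... | tri> _ _ _ | tri≈ _ j≡c₂ _ = ⊥-elim (absent₂ j j≡c₂ q)
    ... | tri> _ _ _ | tri> _ _ c₂<j =
      ⊥-elim (vertex-not-between c₁ c₂ _ (m≤n⇒m≤1+n (path-index≤m j)) (inj₂ c₂<j) inside)

    backward : ∀ j → Q (inʳ xs j) → Between c₁ c₂ (vertex (suc (toℕ j))) → Between c₁ c₂ (vertex (toℕ j))
    backward j q inside with <-cmp (toℕ j) c₁ | <-cmp (toℕ j) c₂
    ... | tri< j<c₁ _ _ | _ = ⊥-elim (vertex-not-between c₁ c₂ _ (s≤s (path-index≤m j)) (inj₁ j<c₁) inside)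
    ... | tri≈ _ j≡c₁ _ | _ = ⊥-elim (absent₁ j j≡c₁ q)
    ... | tri> _ _ c₁<j | tri< j<c₂ _ _ = vertex-between c₁ c₂ _ c₂≤m c₁<j (<⇒≤ j<c₂)
    ... | tri> _ _ _ | tri≈ _ j≡c₂ _ = ⊥-elim (absent₂ j j≡c₂ q)
    ... | tri> _ _ _ | tri> _ _ c₂<j =
      ⊥-elim (vertex-not-between c₁ c₂ _ (s≤s (path-index≤m j)) (inj₂ (m<n⇒m<1+n c₂<j)) inside)

    between-closed : ∀ e a b → Q e → Joins G′ e a b → Between c₁ c₂ a → Between c₁ c₂ b
    between-closed e a b q jn inside with split xs P e
    ... | left i =
      ⊥-elim (<⇒≱ (proj₁ (joins-vertices {G} wf (joins-old⁻ i jn))) (≤-trans (m≤m+n V₀ c₁) (proj₁ inside)))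
    ... | right j with joins-path⁻ j jn
    ...   | inj₁ (refl , refl) = forward j q inside
    ...   | inj₂ (refl , refl) = backward j q inside

  module Trees (S : Vec Bool (length xs)) (T : Vec Bool (length P)) where

    S∪T : Vec Bool (length (xs ++ P))
    S∪T = joinˢ xs S T

    Kept : Fin (E G′) → Set
    Kept = In S∪T

    kept-old⁻ : ∀ i → Kept (inˡ xs i) → In S i
    kept-old⁻ i = trans (sym (lookup-joinˢ-inˡ xs S T i))

    kept-old⁺ : ∀ i → In S i → Kept (inˡ xs i)
    kept-old⁺ i = trans (lookup-joinˢ-inˡ xs S T i)

    kept-path⁻ : ∀ j → Kept (inʳ xs j) → lookup T j ≡ true
    kept-path⁻ j = trans (sym (lookup-joinˢ-inʳ xs S T j))

    kept-path⁺ : ∀ j → lookup T j ≡ true → Kept (inʳ xs j)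
    kept-path⁺ j = trans (lookup-joinˢ-inʳ xs S T j)

    missing : ∀ c → lookup T c ≡ false → ∀ j → toℕ j ≡ toℕ c → ¬ Kept (inʳ xs j)
    missing c Tc≡false j j≡c =
      false⇒¬In {S = T} (subst (λ z → lookup T z ≡ false) (sym (toℕ-injective j≡c)) Tc≡false) ∘ kept-path⁻ j

    lift-old : ∀ {R : Fin (E G) → Set} {Q : Fin (E G′) → Set} → (∀ i → R i → Q (inˡ xs i)) →
      ∀ {u v} → Reach G R u v → Reach G′ Q u v
    lift-old R⇒Q = reach-map G G′ id λ i a b ri j → edge-reach (R⇒Q i ri) (joins-old⁺ i j)

    two-missing⇒disconnected : 2 ≤ falses T → ¬ ReachConnected G′ Kept
    two-missing⇒disconnected 2≤falses conn with falses≥2⇒two-falses T 2≤falses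
    ... | c₁ , c₂ , c₁<c₂ , Tc₁≡false , Tc₂≡false =
      vertex-not-between (toℕ c₁) (toℕ c₂) 0 z≤n (inj₁ z≤n) r-between
      where
      open Isolated {Kept} (toℕ c₁) (toℕ c₂) c₁<c₂ (path-index≤m c₂)
        (missing c₁ Tc₁≡false) (missing c₂ Tc₂≡false)
      r-between : Between (toℕ c₁) (toℕ c₂) r
      r-between = reach-closed (Between (toℕ c₁) (toℕ c₂)) between-closed
        (connected-at conn (vertex<V′ (toℕ c₂) (m≤n⇒m≤1+n (path-index≤m c₂))) (old<V′ r<V))
        (vertex-between (toℕ c₁) (toℕ c₂) (toℕ c₂) (path-index≤m c₂) c₁<c₂ ≤-refl)

    module OneMissing (cut : Fin (length P)) (Tcut≡false : lookup T cut ≡ false)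
      (others : ∀ j → j ≢ cut → lookup T j ≡ true) where

      c : ℕ
      c = toℕ cut

      cut-missing : ∀ {Z : Set} j → toℕ j ≡ c → Kept (inʳ xs j) → Z
      cut-missing j j≡c = ⊥-elim ∘ missing cut Tcut≡false j j≡c

      extend-connected : ReachConnected G (In S) → ReachConnected G′ Kept
      extend-connected conn u v =
        let y₁ , y₁<V , u⇝y₁ = reach-old-vertex c present (toℕ u) (toℕ<n u)
            y₂ , y₂<V , v⇝y₂ = reach-old-vertex c present (toℕ v) (toℕ<n v)
        in u⇝y₁ ◅◅ lift-old kept-old⁺ (connected-at conn y₁<V y₂<V) ◅◅ reach-sym v⇝y₂
        where
        present : ∀ j → toℕ j ≢ c → Kept (inʳ xs j)
        present j j≢c = kept-path⁺ j (others j (j≢c ∘ cong toℕ))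

      path-edge-bridge : ∀ j → Kept (inʳ xs j) →
        ¬ Reach G′ (Without Kept (inʳ xs j)) (vertex (toℕ j)) (vertex (suc (toℕ j)))
      path-edge-bridge j kept t⇝t+1 with <-cmp (toℕ j) c
      ... | tri< t<c _ _ =
        vertex-not-between t c t (m≤n⇒m≤1+n t≤m) (inj₁ ≤-refl)
          (reach-closed (Between t c) between-closed (reach-sym t⇝t+1) (vertex-between t c (suc t) c≤m (n<1+n t) t<c))
        where
        t = toℕ j ; t≤m = path-index≤m j ; c≤m = path-index≤m cut
        open Isolated {Without Kept (inʳ xs j)} t c t<c c≤m
          (λ j′ j′≡t (_ , j′≢j) → j′≢j (cong (inʳ xs) (toℕ-injective j′≡t)))
          (λ j′ j′≡c (k , _) → cut-missing j′ j′≡c k)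
      ... | tri≈ _ t≡c _ = cut-missing j t≡c kept
      ... | tri> _ _ c<t =
        vertex-not-between c t (suc t) (s≤s t≤m) (inj₂ (n<1+n t))
          (reach-closed (Between c t) between-closed t⇝t+1 (vertex-between c t t t≤m c<t ≤-refl))
        where
        t = toℕ j ; t≤m = path-index≤m j
        open Isolated {Without Kept (inʳ xs j)} c t c<t t≤m
          (λ j′ j′≡c (k , _) → cut-missing j′ j′≡c k)
          (λ j′ j′≡t (_ , j′≢j) → j′≢j (cong (inʳ xs) (toℕ-injective j′≡t)))

      extend-acyclic : ¬ CycleEdge G (In S) → ¬ CycleEdge G′ Kept
      extend-acyclic acyclic (f , kept , u , w , jn , w⇝u) with split xs P f
      ... | left i = acyclic (i , kept-old⁻ i kept , u , w , jG ,
                       subst₂ (Reach G (Without (In S) i)) (collapse-old c w w<V) (collapse-old c u u<V)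
                         (collapse-reach w⇝u))
        where
        jG = joins-old⁻ i jn
        u<V = proj₁ (joins-vertices {G} wf jG)
        w<V = proj₂ (joins-vertices {G} wf jG)
        open Collapse {Without Kept (inˡ xs i)} {Without (In S) i} c (path-index≤m cut)
          (λ i′ (k , i′≢i) → kept-old⁻ i′ k , i′≢i ∘ cong (inˡ xs))
          (λ j j≡c (k , _) → cut-missing j j≡c k)
      ... | right j = path-edge-bridge j kept (reach-resp-ends {G′} (joins-sym {G′} jn) (joins-path j) w⇝u)

      restrict-connected : ReachConnected G′ Kept → ReachConnected G (In S)
      restrict-connected conn u v =
        subst₂ (Reach G (In S)) (collapse-old c _ (toℕ<n u)) (collapse-old c _ (toℕ<n v))
          (collapse-reach (connected-at conn (old<V′ (toℕ<n u)) (old<V′ (toℕ<n v))))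
        where open Collapse {Kept} {In S} c (path-index≤m cut) kept-old⁻ cut-missing

      restrict-acyclic : ¬ CycleEdge G′ Kept → ¬ CycleEdge G (In S)
      restrict-acyclic acyclic (f , pf , u , w , jG , w⇝u) =
        acyclic (inˡ xs f , kept-old⁺ f pf , u , w , joins-old⁺ f jG ,
                 lift-old (λ i (k , i≢f) → kept-old⁺ i k , i≢f ∘ inˡ-injective xs) w⇝u)

      isTree⇒isTree′ : IsTree G (In S) → IsTree G′ Kept
      isTree⇒isTree′ (conn , acyclic) = extend-connected conn , extend-acyclic acyclic

      isTree′⇒isTree : IsTree G′ Kept → IsTree G (In S)
      isTree′⇒isTree (conn , acyclic) = restrict-connected conn , restrict-acyclic acyclic

    module AllPresent (all-true : ∀ j → lookup T j ≡ true) where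

      kept-path : ∀ j → Kept (inʳ xs j)
      kept-path j = kept-path⁺ j (all-true j)

      path-avoiding : ∀ {f} → (∀ j → inʳ xs j ≢ f) → Reach G′ (Without Kept f) r s
      path-avoiding j≢f = path-reach λ j → kept-path j , j≢f j

      first-edge : Fin (length P)
      first-edge = proj₁ (path-index 0 (s≤s z≤n))

      first-edge≡0 : toℕ first-edge ≡ 0
      first-edge≡0 = proj₂ (path-index 0 (s≤s z≤n))

      joins-first : Joins G′ (inʳ xs first-edge) r (vertex 1)
      joins-first =
        subst (λ z → Joins G′ (inʳ xs first-edge) (vertex z) (vertex (suc z))) first-edge≡0 (joins-path first-edge)

      rest-of-path : Reach G′ (Without Kept (inʳ xs first-edge)) (vertex 1) s
      rest-of-path = subst (Reach G′ _ (vertex 1)) vertex-last (path-segment 1 m ≤-refl λ j 1≤j _ →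
        kept-path j , λ j≡first → <⇒≢ 1≤j (sym (trans (cong toℕ (inʳ-injective xs j≡first)) first-edge≡0)))

      r≡s⇒cycleEdge : r ≡ s → CycleEdge G′ Kept
      r≡s⇒cycleEdge r≡s =
        inʳ xs first-edge , kept-path first-edge , r , vertex 1 , joins-first ,
        subst (Reach G′ _ (vertex 1)) (sym r≡s) rest-of-path

      -- the glued path plays the role of an edge e₀ from r to s
      module WithEdge (e₀ : Fin (length xs)) (e₀-joins : Joins G e₀ r s) where

        S₀ : Vec Bool (length xs)
        S₀ = S [ e₀ ]≔ true

        e₀∈S₀ : In S₀ e₀
        e₀∈S₀ = lookup∘update e₀ S true

        S⊆S₀ : ∀ i → In S i → In S₀ i
        S⊆S₀ i Si with i ≟ᶠ e₀
        ... | yes refl = e₀∈S₀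
        ... | no i≢e₀ = trans (lookup∘update′ i≢e₀ S true) Si

        S₀⊆S : ∀ i → In S₀ i → i ≢ e₀ → In S i
        S₀⊆S i S₀i i≢e₀ = trans (sym (lookup∘update′ i≢e₀ S true)) S₀i

        lift-replacing-e₀ : ∀ {R : Fin (E G) → Set} {Q : Fin (E G′) → Set} →
          (∀ i → R i → i ≢ e₀ → Q (inˡ xs i)) → (R e₀ → Reach G′ Q r s) →
          ∀ {u v} → Reach G R u v → Reach G′ Q u v
        lift-replacing-e₀ {R} {Q} old e₀↦path = reach-map G G′ id edge
          where
          edge : ∀ i a b → R i → Joins G i a b → Reach G′ Q a b
          edge i a b ri jn with i ≟ᶠ e₀
          ... | yes refl = reach-resp-ends {G} e₀-joins jn (e₀↦path ri)
          ... | no i≢e₀ = edge-reach (old i ri i≢e₀) (joins-old⁺ i jn)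

        e₀∉S : IsTree G′ Kept → lookup S e₀ ≡ false
        e₀∉S (_ , acyclic) with lookup S e₀ in Se₀
        ... | false = refl
        ... | true = ⊥-elim (acyclic (inˡ xs e₀ , kept-old⁺ e₀ Se₀ , r , s , joins-old⁺ e₀ e₀-joins ,
                              reach-sym (path-avoiding (λ j → inˡ≢inʳ xs e₀ j ∘ sym))))

        contract-connected : ReachConnected G′ Kept → ReachConnected G (In S₀)
        contract-connected conn u v =
          subst₂ (Reach G (In S₀)) (collapse-old m _ (toℕ<n u)) (collapse-old m _ (toℕ<n v))
            (collapse-reach (connected-at conn (old<V′ (toℕ<n u)) (old<V′ (toℕ<n v))))
          where
          open Collapse {Kept} {In S₀} m ≤-refl (λ i → S⊆S₀ i ∘ kept-old⁻ i) (λ _ _ _ → edge-reach e₀∈S₀ e₀-joins)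

        contract-acyclic : ¬ CycleEdge G′ Kept → ¬ CycleEdge G (In S₀)
        contract-acyclic acyclic (f , S₀f , u , w , jG , w⇝u) with f ≟ᶠ e₀
        ... | yes refl = acyclic (inʳ xs first-edge , kept-path first-edge , r , vertex 1 , joins-first ,
                           rest-of-path ◅◅ lift-old (λ i Si → kept-old⁺ i Si , inˡ≢inʳ xs i first-edge) s⇝r)
          where
          s⇝r : Reach G (In S) s r
          s⇝r = reach-resp-ends {G} (joins-sym {G} jG) (joins-sym {G} e₀-joins)
                  (reach-mono (λ i (S₀i , i≢e₀) → S₀⊆S i S₀i i≢e₀) w⇝u)
        ... | no f≢e₀ = acyclic (inˡ xs f , kept-old⁺ f (S₀⊆S f S₀f f≢e₀) , u , w , joins-old⁺ f jG ,
                          lift-replacing-e₀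
                            (λ i (S₀i , i≢f) i≢e₀ → kept-old⁺ i (S₀⊆S i S₀i i≢e₀) , i≢f ∘ inˡ-injective xs)
                            (λ _ → path-avoiding (λ j → inˡ≢inʳ xs f j ∘ sym)) w⇝u)

        isTree′⇒isTree₀ : IsTree G′ Kept → IsTree G (In S₀)
        isTree′⇒isTree₀ (conn , acyclic) = contract-connected conn , contract-acyclic acyclic

        module _ (Se₀≡false : lookup S e₀ ≡ false) where

          S-avoids-e₀ : ∀ i → In S i → i ≢ e₀
          S-avoids-e₀ i Si i≡e₀ = false⇒¬In {S = S} Se₀≡false (subst (In S) i≡e₀ Si)

          expand-connected : ReachConnected G (In S₀) → ReachConnected G′ Kept
          expand-connected conn u v =
            let y₁ , y₁<V , u⇝y₁ = reach-old-vertex (suc m) (λ j _ → kept-path j) (toℕ u) (toℕ<n u)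
                y₂ , y₂<V , v⇝y₂ = reach-old-vertex (suc m) (λ j _ → kept-path j) (toℕ v) (toℕ<n v)
            in u⇝y₁
               ◅◅ lift-replacing-e₀ (λ i S₀i i≢e₀ → kept-old⁺ i (S₀⊆S i S₀i i≢e₀)) (λ _ → path-reach kept-path)
                    (connected-at conn y₁<V y₂<V)
               ◅◅ reach-sym v⇝y₂

          expand-acyclic : ¬ CycleEdge G (In S₀) → ¬ CycleEdge G′ Kept
          expand-acyclic acyclic (f , kept , u , w , jn , w⇝u) with split xs P f
          ... | left i = acyclic (i , S⊆S₀ i Si , u , w , jG ,
                           subst₂ (Reach G (Without (In S₀) i)) (collapse-old m w w<V) (collapse-old m u u<V)
                             (collapse-reach w⇝u))
            where
            Si = kept-old⁻ i kept
            jG = joins-old⁻ i jn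
            u<V = proj₁ (joins-vertices {G} wf jG)
            w<V = proj₂ (joins-vertices {G} wf jG)
            open Collapse {Without Kept (inˡ xs i)} {Without (In S₀) i} m ≤-refl
              (λ i′ (k , i′≢i) → S⊆S₀ i′ (kept-old⁻ i′ k) , i′≢i ∘ cong (inˡ xs))
              (λ _ _ _ → edge-reach (e₀∈S₀ , S-avoids-e₀ i Si ∘ sym) e₀-joins)
          ... | right j = acyclic (e₀ , e₀∈S₀ , r , s , e₀-joins ,
                            subst₂ (Reach G (Without (In S₀) e₀))
                              (collapse-vertex> c (suc c) (s≤s c≤m) (n<1+n c)) (collapse-vertex≤ c c c≤m ≤-refl)
                              (collapse-reach (reach-resp-ends {G′} (joins-sym {G′} jn) (joins-sym {G′} (joins-path j))
                                                 w⇝u)))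
            where
            c = toℕ j
            c≤m = path-index≤m j
            open Collapse {Without Kept (inʳ xs j)} {Without (In S₀) e₀} c c≤m
              (λ i (k , _) → S⊆S₀ i (kept-old⁻ i k) , S-avoids-e₀ i (kept-old⁻ i k))
              (λ j′ j′≡c (_ , j′≢j) → ⊥-elim (j′≢j (cong (inʳ xs) (toℕ-injective j′≡c))))

          isTree₀⇒isTree′ : IsTree G (In S₀) → IsTree G′ Kept
          isTree₀⇒isTree′ (conn , acyclic) = expand-connected conn , expand-acyclic acyclic

  OneGap : Vec Bool (length (xs ++ P)) → Set
  OneGap S′ = IsTree G (In (leftˢ xs S′)) × falses (rightˢ xs S′) ≡ 1

  NoGap : Vec Bool (length (xs ++ P)) → Set
  NoGap S′ = falses (rightˢ xs S′) ≡ 0 × IsTree G′ (In S′)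

  module Parts (S′ : Vec Bool (length (xs ++ P))) where
    open Trees (leftˢ xs S′) (rightˢ xs S′) public

    isTree′-parts : IsTree G′ (In S′) → IsTree G′ Kept
    isTree′-parts = subst (IsTree G′ ∘ In) (sym (joinˢ-leftˢ-rightˢ xs S′))

    isTree′-whole : IsTree G′ Kept → IsTree G′ (In S′)
    isTree′-whole = subst (IsTree G′ ∘ In) (joinˢ-leftˢ-rightˢ xs S′)

  isTree′-cases : ∀ S′ → IsTree G′ (In S′) → OneGap S′ ⊎ NoGap S′
  isTree′-cases S′ tree with falses (rightˢ xs S′) in gaps
  ... | zero = inj₂ (refl , tree)
  ... | suc zero = inj₁ (OneMissing.isTree′⇒isTree cut Tcut≡false others (isTree′-parts tree) , refl)
    where
    open Parts S′
    cut = proj₁ (falses≡1⇒unique-false (rightˢ xs S′) gaps)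
    Tcut≡false = proj₁ (proj₂ (falses≡1⇒unique-false (rightˢ xs S′) gaps))
    others = proj₂ (proj₂ (falses≡1⇒unique-false (rightˢ xs S′) gaps))
  ... | suc (suc _) =
    ⊥-elim (two-missing⇒disconnected (subst (2 ≤_) (sym gaps) (s≤s (s≤s z≤n))) (proj₁ (isTree′-parts tree)))
    where open Parts S′

  oneGap⇒isTree′ : ∀ S′ → OneGap S′ → IsTree G′ (In S′)
  oneGap⇒isTree′ S′ (tree , gaps) =
    let cut , Tcut≡false , others = falses≡1⇒unique-false (rightˢ xs S′) gaps
    in isTree′-whole (OneMissing.isTree⇒isTree′ cut Tcut≡false others tree)
    where open Parts S′

  joinᵖ : Vec Bool (length xs) × Vec Bool (length P) → Vec Bool (length (xs ++ P))
  joinᵖ (S , T) = joinˢ xs S T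

  count-oneGap : ∀ {a} → TreeCount G a → Count OneGap (a * suc m)
  count-oneGap {a} trees = subst (Count OneGap) (cong (a *_) (length-pathEdges r s V₀ m)) (count-resp
    (λ { _ ((S , T) , (tree , gaps) , refl) →
           subst (IsTree G ∘ In) (sym (leftˢ-joinˢ xs S T)) tree , trans (cong falses (rightˢ-joinˢ xs S T)) gaps })
    (λ S′ oneGap → (leftˢ xs S′ , rightˢ xs S′) , oneGap , joinˢ-leftˢ-rightˢ xs S′)
    (count-image joinᵖ (λ _ _ → joinˢ-injective xs) (count-× trees (count-falses≡1 (length P)))))

  count-oneGap-keeping : ∀ {a} → TreeCount G a → (j : Fin (length P)) →
    Count (λ S′ → OneGap S′ × lookup (rightˢ xs S′) j ≡ true) (a * m)
  count-oneGap-keeping {a} trees j = subst (Count _) (cong (λ n → a * pred n) (length-pathEdges r s V₀ m)) (count-resp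
    (λ { _ ((S , T) , (tree , gaps , Tj) , refl) →
           (subst (IsTree G ∘ In) (sym (leftˢ-joinˢ xs S T)) tree , trans (cong falses (rightˢ-joinˢ xs S T)) gaps) ,
           trans (cong (λ T′ → lookup T′ j) (rightˢ-joinˢ xs S T)) Tj })
    (λ S′ ((tree , gaps) , Tj) → (leftˢ xs S′ , rightˢ xs S′) , (tree , gaps , Tj) , joinˢ-leftˢ-rightˢ xs S′)
    (count-image joinᵖ (λ _ _ → joinˢ-injective xs) (count-× trees (count-falses≡1-true-at (length P) j))))

  oneGap-noGap-disjoint : ∀ S′ → OneGap S′ → NoGap S′ → ⊥
  oneGap-noGap-disjoint S′ (_ , one) (none , _) = 0≢1+n (trans (sym none) one)

  count-trees′ : ∀ {a b} → TreeCount G a → Count NoGap b → TreeCount G′ (a * suc m + b)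
  count-trees′ trees noGaps = count-resp
    (λ { S′ (inj₁ oneGap) → oneGap⇒isTree′ S′ oneGap ; S′ (inj₂ (_ , tree)) → tree })
    isTree′-cases
    (count-⊎ oneGap-noGap-disjoint (count-oneGap trees) noGaps)

  count-trees′-through : ∀ {a b} → TreeCount G a → Count NoGap b → (j : Fin (length P)) →
    Count (λ S′ → IsTree G′ (In S′) × In S′ (inʳ xs j)) (a * m + b)
  count-trees′-through trees noGaps j = count-resp
    (λ { S′ (inj₁ (oneGap , Tj)) → oneGap⇒isTree′ S′ oneGap , trans (lookup-inʳ-rightˢ xs S′ j) Tj
       ; S′ (inj₂ (none , tree)) →
           tree , trans (lookup-inʳ-rightˢ xs S′ j) (falses≡0⇒lookup≡true (rightˢ xs S′) none j) })
    (λ S′ (tree , S′j) → [ (λ oneGap → inj₁ (oneGap , trans (sym (lookup-inʳ-rightˢ xs S′ j)) S′j)) , inj₂ ]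
                            (isTree′-cases S′ tree))
    (count-⊎ (λ S′ (oneGap , _) → oneGap-noGap-disjoint S′ oneGap) (count-oneGap-keeping trees j) noGaps)

  count-noGap-loop : r ≡ s → Count NoGap 0
  count-noGap-loop r≡s = count-∅ λ S′ (none , tree) →
    proj₂ (isTree′-parts S′ tree)
      (AllPresent.r≡s⇒cycleEdge S′ (falses≡0⇒lookup≡true (rightˢ xs S′) none) r≡s)
    where open Parts

  count-noGap-edge : ∀ {b} (e₀ : Fin (length xs)) → Joins G e₀ r s →
    Count (λ S → IsTree G (In S) × In S e₀) b → Count NoGap b
  count-noGap-edge e₀ e₀-joins = count-resp forward backward ∘ count-image remove-e₀ injective
    where
    whole : Vec Bool (length P)
    whole = replicate (length P) true

    remove-e₀ : Vec Bool (length xs) → Vec Bool (length (xs ++ P))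
    remove-e₀ S = joinˢ xs (S [ e₀ ]≔ false) whole

    restore : ∀ S → In S e₀ → (S [ e₀ ]≔ false) [ e₀ ]≔ true ≡ S
    restore S Se₀ = trans ([]≔-idempotent S e₀) (trans (cong (S [ e₀ ]≔_) (sym Se₀)) ([]≔-lookup S e₀))

    injective : ∀ {S S₁} → _ → _ → remove-e₀ S ≡ remove-e₀ S₁ → S ≡ S₁
    injective {S} {S₁} (_ , Se₀) (_ , S₁e₀) eq =
      trans (sym (restore S Se₀))
        (trans (cong (_[ e₀ ]≔ true) (proj₁ (,-injective (joinˢ-injective xs eq)))) (restore S₁ S₁e₀))

    forward : ∀ S′ → Σ _ (λ S → (IsTree G (In S) × In S e₀) × remove-e₀ S ≡ S′) → NoGap S′
    forward _ (S , (tree , Se₀) , refl) =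
      trans (cong falses (rightˢ-joinˢ xs _ whole)) (falses-replicate (length P)) ,
      Trees.AllPresent.WithEdge.isTree₀⇒isTree′ (S [ e₀ ]≔ false) whole
        (falses≡0⇒lookup≡true whole (falses-replicate (length P))) e₀ e₀-joins (lookup∘update e₀ S false)
        (subst (IsTree G ∘ In) (sym (restore S Se₀)) tree)

    backward : ∀ S′ → NoGap S′ → Σ _ (λ S → (IsTree G (In S) × In S e₀) × remove-e₀ S ≡ S′)
    backward S′ (none , tree) =
      let e₀∉ , tree₀ = e₀∉S (isTree′-parts tree) , isTree′⇒isTree₀ (isTree′-parts tree)
      in leftˢ xs S′ [ e₀ ]≔ true , (tree₀ , lookup∘update e₀ (leftˢ xs S′) true) ,
         trans (cong₂ (joinˢ xs) (trans ([]≔-idempotent (leftˢ xs S′) e₀)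
                                         (trans (cong (leftˢ xs S′ [ e₀ ]≔_) (sym e₀∉)) ([]≔-lookup (leftˢ xs S′) e₀)))
                                  (sym (falses≡0⇒≡replicate (rightˢ xs S′) none)))
               (joinˢ-leftˢ-rightˢ xs S′)
      where
      open Parts S′
      open AllPresent (falses≡0⇒lookup≡true (rightˢ xs S′) none)
      open WithEdge e₀ e₀-joins

-- Accordions

FreeEdgeCounts : State → ℕ → Set
FreeEdgeCounts st b = (i : Fin (length (free st))) → Σ (Fin (E (graphOf st))) λ e →
  List.lookup (edges (graphOf st)) e ≡ List.lookup (free st) i × Count (λ S → IsTree (graphOf st) (In S) × In S e) b

Invariant : State → ℕ × ℕ → Set
Invariant st (a , b) = WellFormed (graphOf st) × TreeCount (graphOf st) a × FreeEdgeCounts st b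

glue-counts : ℕ → ℕ × ℕ → ℕ × ℕ
glue-counts m (a , b) = a * suc m + b , a * m + b

glue-invariant : ∀ G wf r s r<V s<V m {a b} → TreeCount G a → Count (Extension.NoGap G wf r s r<V s<V m) b →
  Invariant (state (graph (V G + m) (edges G ++ pathEdges r s (V G) m)) (pathEdges r s (V G) m)) (glue-counts m (a , b))
glue-invariant G wf r s r<V s<V m trees noGaps =
  wellFormed′ , count-trees′ trees noGaps , λ j → inʳ xs j , lookup-inʳ xs j , count-trees′-through trees noGaps j
  where open Extension G wf r s r<V s<V m

joins-orient : ∀ (G : Graph) e p b → List.lookup (edges G) e ≡ p →
  Joins G e (proj₁ (orient b p)) (proj₂ (orient b p))
joins-orient G e p false eq = inj₁ eq
joins-orient G e p true eq = inj₂ eq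

grow-invariant : ∀ k {st a b} → Invariant st (a , b) → (i : Fin (length (free st))) (o : Bool) →
  Invariant (grow k st i o) (glue-counts (k ∸ 2) (a , b))
grow-invariant k {st} (wf , trees , free-counts) i o =
  let e , ends≡ , through-e = free-counts i
      jn = joins-orient (graphOf st) e (List.lookup (free st) i) o ends≡
      r<V , s<V = joins-vertices {graphOf st} wf jn
  in glue-invariant (graphOf st) wf _ _ r<V s<V (k ∸ 2) trees
       (Extension.count-noGap-edge _ wf _ _ r<V s<V (k ∸ 2) e jn through-e)

point : Graph
point = graph 1 []

point-trees : TreeCount point 1
point-trees = [] ∷ [] , [] ∷ [] , refl ,
  λ { [] → (λ _ → (λ { zero zero → ε }) , λ { (() , _) }) , λ _ → here refl }

cycle-as-path : ∀ n (f : ℕ → ℕ) a → (∀ i → f i ≡ a + i) →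
  map (λ i → (i , suc i)) (applyUpTo f n) ++ (a + n , 0) ∷ [] ≡ pathEdges a 0 (suc a) n
cycle-as-path zero f a _ = cong (λ x → (x , 0) ∷ []) (+-identityʳ a)
cycle-as-path (suc n) f a f≗a+ = cong₂ _∷_ (cong (λ x → (x , suc x)) (trans (f≗a+ 0) (+-identityʳ a)))
  (trans (cong (λ x → map (λ i → (i , suc i)) (applyUpTo (f ∘ suc) n) ++ (x , 0) ∷ []) (+-suc a n))
         (cycle-as-path n (f ∘ suc) (suc a) (λ i → trans (f≗a+ (suc i)) (+-suc a i))))

-- the k-cycle is a path with k - 1 new vertices glued onto a single vertex, both ends at the old vertex
initial-invariant : ∀ k₁ → Invariant (initial (suc k₁)) (glue-counts k₁ (1 , 0))
initial-invariant k₁ =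
  subst (λ es → Invariant (state (graph (suc k₁) es) es) (glue-counts k₁ (1 , 0)))
    (sym (cycle-as-path k₁ id 0 (λ _ → refl)))
    (glue-invariant point (λ ()) 0 0 (s≤s z≤n) (s≤s z≤n) k₁ point-trees
      (Extension.count-noGap-loop point (λ ()) 0 0 (s≤s z≤n) (s≤s z≤n) k₁ refl))

-- Starting from (1 , 1) instead of the point's (1 , 0) absorbs the longer path glued in the first step.
treeCounts : ℕ → ℕ → ℕ × ℕ
treeCounts m zero = 1 , 1
treeCounts m (suc n) = glue-counts m (treeCounts m n)

glue-counts-point : ∀ m → glue-counts (suc m) (1 , 0) ≡ glue-counts m (1 , 1)
glue-counts-point m = cong₂ _,_ (lemma (suc m)) (lemma m)
  where
  lemma : ∀ x → 1 * suc x + 0 ≡ 1 * x + 1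
  lemma = solve-∀

accordion-invariant : ∀ {k n st} → 3 ≤ k → IsAccordion k n st → Invariant st (treeCounts (k ∸ 2) n)
accordion-invariant (s≤s (s≤s (s≤s {n = k₀} _))) first =
  subst (Invariant (initial (3 + k₀))) (glue-counts-point (suc k₀)) (initial-invariant (2 + k₀))
accordion-invariant {k} 3≤k (next {st = st} accordion i o) =
  grow-invariant k {st} (accordion-invariant 3≤k accordion) i o

glue-counts-twice : ∀ m a b → (a * suc m + b) * suc m + (a * m + b) + a ≡ suc (suc m) * (a * suc m + b)
glue-counts-twice = solve-∀

treeCounts-recurrence : ∀ m n →
  proj₁ (treeCounts m (2 + n)) + proj₁ (treeCounts m n) ≡ (2 + m) * proj₁ (treeCounts m (1 + n))
treeCounts-recurrence m n = glue-counts-twice m (proj₁ (treeCounts m n)) (proj₂ (treeCounts m n))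

theorem2 : Σ (ℕ → ℕ → ℕ) λ τA →
    ((k n : ℕ) → 3 ≤ k → 1 ≤ n → (st : State) → IsAccordion k n st →
    SpanningTreeCount (graphOf st) (τA k n))
    × ((k n : ℕ) → 3 ≤ k → 3 ≤ n →
    τA k n + τA k (n ∸ 2) ≡ k * τA k (n ∸ 1))
theorem2 = τA , spanning-trees , recurrence
  where
  τA : ℕ → ℕ → ℕ
  τA k n = proj₁ (treeCounts (k ∸ 2) n)

  spanning-trees : (k n : ℕ) → 3 ≤ k → 1 ≤ n → (st : State) → IsAccordion k n st →
    SpanningTreeCount (graphOf st) (τA k n)
  spanning-trees k n 3≤k _ st accordion =
    count-resp (λ _ → isTree⇒isSpanningTree) (λ _ → isSpanningTree⇒isTree)
      (proj₁ (proj₂ (accordion-invariant 3≤k accordion)))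

  recurrence : (k n : ℕ) → 3 ≤ k → 3 ≤ n → τA k n + τA k (n ∸ 2) ≡ k * τA k (n ∸ 1)
  recurrence (suc (suc m)) (suc (suc (suc n))) (s≤s (s≤s _)) (s≤s (s≤s (s≤s _))) = treeCounts-recurrence m (suc n)
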